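{- Let $U=\{u_1,\dots,u_{2^m}\}\subseteq\mathbb F_2^n\setminus\{0\}$ be a set of $2^m$ distinct nonzero vectors, and let $B:\mathbb F_2^n\to\mathbb F_2^m$ be a uniformly random linear map. Fix $y\in\mathbb F_2^m$ and define $Z_y:=|\{i: Bu_i=y\}|$. Then for every integer $r\ge 0$, setting $a=\lceil \log(r+2)\rceil$, \[ \Pr[Z_y>r]\le \left(\prod_{j=0}^{a-1}(r+2-2^j)\right)^{ -1}. \]
   Context: $\log$ is base $2$. A uniformly random linear map is chosen uniformly among all $\mathbb F_2$-linear maps $\mathbb F_2^n\to\mathbb F_2^m$. -}

module Defs where

open import Data.Bool using (Bool; true; false; _xor_; _∧_)
open import Data.Nat using (ℕ; zero; suc; _+_; _*_; _∸_; _^_; _<_; _≤_)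
open import Data.Nat.Logarithm using (⌈log₂_⌉)
open import Data.Vec using (Vec; []; _∷_; map; zipWith; foldr)
open import Data.List using (List; []; _∷_; length; filter; concatMap)
import Data.List as L
open import Data.Vec.Properties using (≡-dec)
open import Data.Bool.Properties using () renaming (_≟_ to _≟B_)
open import Relation.Binary.PropositionalEquality using (_≡_)
open import Relation.Nullary using (Dec; ¬_)
open import Data.Nat.Properties using (_<?_)

-- Vectors in F₂^n are represented as Vec Bool n (true = 1, xor = +, ∧ = ·).
F2^ : ℕ → Set
F2^ n = Vec Bool n

zeroV : (n : ℕ) → F2^ n
zeroV zero = []
zeroV (suc n) = false ∷ zeroV n

_≟V_ : ∀ {n} → (u v : F2^ n) → Dec (u ≡ v)
_≟V_ = ≡-dec _≟B_

dot : ∀ {n} → F2^ n → F2^ n → Bool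
dot u v = foldr _ _xor_ false (zipWith _∧_ u v)

-- A linear map F₂^n → F₂^m, given by its m × n matrix (list of m rows).
LinMap : ℕ → ℕ → Set
LinMap n m = Vec (F2^ n) m

apply : ∀ {n m} → LinMap n m → F2^ n → F2^ m
apply B u = map (λ row → dot row u) B

allVecsOf : {A : Set} → List A → (k : ℕ) → List (Vec A k)
allVecsOf xs zero = [] ∷ []
allVecsOf xs (suc k) = concatMap (λ x → L.map (x ∷_) (allVecsOf xs k)) xs

allF2^ : (n : ℕ) → List (F2^ n)
allF2^ n = allVecsOf (false ∷ true ∷ []) n

-- The (finite) sample space: all linear maps F₂^n → F₂^m (each exactly once).
allLinMaps : (n m : ℕ) → List (LinMap n m)
allLinMaps n m = allVecsOf (allF2^ n) m

Z : ∀ {n m} → List (F2^ n) → F2^ m → LinMap n m → ℕ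
Z U y B = length (filter (λ u → apply B u ≟V y) U)

countBad : ∀ {n m} → List (F2^ n) → F2^ m → ℕ → ℕ
countBad {n} {m} U y r = length (filter (λ B → r <? Z U y B) (allLinMaps n m))

prodTerm : ℕ → ℕ → ℕ
prodTerm r zero = 1
prodTerm r (suc a) = prodTerm r a * (r + 2 ∸ 2 ^ a)

aOf : ℕ → ℕ
aOf r = ⌈log₂ (r + 2) ⌉

{-# OPTIONS --safe #-}
-- Double count the pairs (B, t) in which t = (t₁, …, t_a) is a tuple of vectors of U, each tᵢ outside
-- the span of t_{i+1}, …, t_a, and B tᵢ = y for every i.
-- If Z_y(B) > r such tuples can be chosen greedily from the last entry backwards: k chosen entries span
-- at most 2^k vectors, one of which is 0 ∉ U, so at least r + 2 - 2^k of the > r vectors u ∈ U with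
-- B u = y are still available.  Hence B lies in at least ∏_{j<a} (r + 2 - 2^j) pairs.
-- Conversely the entries of a tuple t are linearly independent, so by Gaussian elimination each row of
-- B is confined to an affine subspace with at most 2^(n-a) points, and t lies in at most 2^(nm) / 2^(am)
-- pairs.  There are |U|^a = 2^(am) tuples, so there are at most 2^(nm) pairs, the number of maps B.
module Submission where

open import Defs
open import Level using (0ℓ)
open import Function using (_∘_; id)
open import Algebra.Bundles using (AbelianGroup; CommutativeMonoid; CommutativeRing)
import Algebra.Properties.AbelianGroup as AbelianGroupProperties
import Algebra.Properties.CommutativeSemigroup as CommutativeSemigroupProperties
open import Data.Bool using (Bool; true; false; not; _∧_; _xor_)
open import Data.Bool.Properties
  using ( xor-assoc; xor-comm; xor-same; xor-∧-commutativeRing; ∧-comm; ∧-commutativeMonoid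
        ; ∧-zeroʳ; ∧-identityʳ; ∧-distribˡ-xor; ∧-distribʳ-xor )
  renaming (_≟_ to _≟B_)
open import Data.Empty using (⊥-elim)
open import Data.Fin using (Fin; zero; suc)
open import Data.List using (List; []; _∷_; length; filter; concatMap; _++_)
import Data.List as List
open import Data.List.Properties using (length-map; length-++-sucʳ)
open import Data.List.Membership.Propositional using (_∈_; _∉_; lose)
open import Data.List.Membership.Propositional.Properties
  using (∈-map⁺; ∈-concat⁺′; ∈-∃++; ∈-++⁻; ∈-++⁺ˡ; ∈-++⁺ʳ)
open import Data.List.Relation.Unary.All using (All; []; _∷_)
import Data.List.Relation.Unary.All as All
open import Data.List.Relation.Unary.All.Properties using (¬Any⇒All¬; All¬⇒¬Any; all-filter; filter⁺)
open import Data.List.Relation.Unary.Any using (here; there; any?; satisfied)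
open import Data.List.Relation.Unary.Unique.Propositional using (Unique)
import Data.List.Relation.Unary.Unique.Propositional.Properties as UniqueProperties
open import Data.List.Relation.Unary.AllPairs using (_∷_)
open import Data.Nat using (ℕ; zero; suc; _+_; _*_; _∸_; _^_; _≤_; z≤n; s≤s; _<?_)
open import Data.Nat.Properties
open import Data.Product using (_×_; _,_; proj₂)
open import Data.Sum using (_⊎_; inj₁; inj₂)
open import Data.Unit using (⊤; tt)
open import Data.Vec using (Vec; []; _∷_; map; zipWith; insertAt)
open import Data.Vec.Properties using (zipWith-assoc; zipWith-comm; ∷-injective)
open import Data.Vec.Relation.Unary.All using ([]; _∷_) renaming (All to Allᵛ; all? to allᵛ?; universal to universalᵛ)
import Data.Vec.Relation.Unary.All as Allᵛ
open import Relation.Binary.PropositionalEquality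
open import Relation.Binary.PropositionalEquality.Algebra using (isMagma)
open import Relation.Nullary using (Dec; yes; no; does; ¬_; ¬?; _×-dec_)
open import Relation.Nullary.Decidable using (dec-false)
open import Relation.Unary using (Pred; Decidable)

private variable
  A B : Set
  n m k : ℕ

module ∧-Props = CommutativeSemigroupProperties (CommutativeMonoid.commutativeSemigroup ∧-commutativeMonoid)
module xor-Props = CommutativeSemigroupProperties (CommutativeRing.+-commutativeSemigroup xor-∧-commutativeRing)
module +-Props = CommutativeSemigroupProperties +-commutativeSemigroup
module *-Props = CommutativeSemigroupProperties *-commutativeSemigroup

-- Finite sums and counting

∑ : List A → (A → ℕ) → ℕ
∑ []       f = 0
∑ (x ∷ xs) f = f x + ∑ xs f

module _ {f g : A → ℕ} where

  ∑-cong : (xs : List A) → (∀ x → f x ≡ g x) → ∑ xs f ≡ ∑ xs g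
  ∑-cong []       f≗g = refl
  ∑-cong (x ∷ xs) f≗g = cong₂ _+_ (f≗g x) (∑-cong xs f≗g)

  ∑-mono : (xs : List A) → (∀ x → f x ≤ g x) → ∑ xs f ≤ ∑ xs g
  ∑-mono []       f≤g = z≤n
  ∑-mono (x ∷ xs) f≤g = +-mono-≤ (f≤g x) (∑-mono xs f≤g)

  ∑-+ : (xs : List A) → ∑ xs (λ x → f x + g x) ≡ ∑ xs f + ∑ xs g
  ∑-+ []       = refl
  ∑-+ (x ∷ xs) = trans (cong (f x + g x +_) (∑-+ xs)) (+-Props.interchange (f x) (g x) _ _)

∑-++ : (xs ys : List A) (f : A → ℕ) → ∑ (xs ++ ys) f ≡ ∑ xs f + ∑ ys f
∑-++ []       ys f = refl
∑-++ (x ∷ xs) ys f = trans (cong (f x +_) (∑-++ xs ys f)) (sym (+-assoc (f x) _ _))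

∑-map : (g : A → B) (xs : List A) (f : B → ℕ) → ∑ (List.map g xs) f ≡ ∑ xs (f ∘ g)
∑-map g []       f = refl
∑-map g (x ∷ xs) f = cong (f (g x) +_) (∑-map g xs f)

∑-concatMap : (g : A → List B) (xs : List A) (f : B → ℕ) → ∑ (concatMap g xs) f ≡ ∑ xs (λ x → ∑ (g x) f)
∑-concatMap g []       f = refl
∑-concatMap g (x ∷ xs) f = trans (∑-++ (g x) _ f) (cong (∑ (g x) f +_) (∑-concatMap g xs f))

∑-*ˡ : (c : ℕ) (xs : List A) (f : A → ℕ) → ∑ xs (λ x → c * f x) ≡ c * ∑ xs f
∑-*ˡ c []       f = sym (*-zeroʳ c)
∑-*ˡ c (x ∷ xs) f = trans (cong (c * f x +_) (∑-*ˡ c xs f)) (sym (*-distribˡ-+ c (f x) _))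

∑-*ʳ : (c : ℕ) (xs : List A) (f : A → ℕ) → ∑ xs (λ x → f x * c) ≡ ∑ xs f * c
∑-*ʳ c xs f = trans (∑-cong xs (λ x → *-comm (f x) c)) (trans (∑-*ˡ c xs f) (*-comm c _))

∑-const : (xs : List A) (c : ℕ) → ∑ xs (λ _ → c) ≡ length xs * c
∑-const []       c = refl
∑-const (x ∷ xs) c = cong (c +_) (∑-const xs c)

∑-swap : (xs : List A) (ys : List B) (f : A → B → ℕ) →
         ∑ xs (λ x → ∑ ys (f x)) ≡ ∑ ys (λ y → ∑ xs (λ x → f x y))
∑-swap []       ys f = sym (trans (∑-const ys 0) (*-zeroʳ (length ys)))
∑-swap (x ∷ xs) ys f = trans (cong (∑ ys (f x) +_) (∑-swap xs ys f)) (sym (∑-+ ys))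

∑-product : (xs : List A) (ys : List B) (f : A → ℕ) (g : B → ℕ) →
            ∑ xs (λ x → ∑ ys (λ y → f x * g y)) ≡ ∑ xs f * ∑ ys g
∑-product xs ys f g = trans (∑-cong xs (λ x → ∑-*ˡ (f x) ys g)) (∑-*ʳ (∑ ys g) xs f)

∑≤-by-shares : (xs : List A) {f : A → ℕ} {c : ℕ} → (∀ x → f x * length xs ≤ c) → ∑ xs f ≤ c
∑≤-by-shares []           f≤ = z≤n
∑≤-by-shares xs@(_ ∷ xs′) {f} {c} f≤ = *-cancelʳ-≤ (∑ xs f) c (length xs) (begin
  ∑ xs f * length xs              ≡⟨ ∑-*ʳ (length xs) xs f ⟨
  ∑ xs (λ x → f x * length xs)    ≤⟨ ∑-mono xs f≤ ⟩
  ∑ xs (λ _ → c)                  ≡⟨ ∑-const xs c ⟩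
  length xs * c                   ≡⟨ *-comm (length xs) c ⟩
  c * length xs                   ∎)
  where open ≤-Reasoning

⟦_⟧ : Bool → ℕ
⟦ true  ⟧ = 1
⟦ false ⟧ = 0

⟦⟧-∧ : ∀ a b → ⟦ a ∧ b ⟧ ≡ ⟦ a ⟧ * ⟦ b ⟧
⟦⟧-∧ true  b = sym (+-identityʳ ⟦ b ⟧)
⟦⟧-∧ false b = refl

⟦⟧≤1 : ∀ a → ⟦ a ⟧ ≤ 1
⟦⟧≤1 true  = ≤-refl
⟦⟧≤1 false = z≤n

⟦does⟧*-≤ : {P : Set} (P? : Dec P) {x y : ℕ} → (P → x ≤ y) → ⟦ does P? ⟧ * x ≤ y
⟦does⟧*-≤ (yes p) {x} x≤y = ≤-trans (≤-reflexive (+-identityʳ x)) (x≤y p)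
⟦does⟧*-≤ (no _)      _   = z≤n

count : {P : Pred A 0ℓ} → Decidable P → List A → ℕ
count P? xs = ∑ xs (λ x → ⟦ does (P? x) ⟧)

module _ {P : Pred A 0ℓ} (P? : Decidable P) where

  length-filter : (xs : List A) → length (filter P? xs) ≡ count P? xs
  length-filter []       = refl
  length-filter (x ∷ xs) with does (P? x)
  ... | true  = cong suc (length-filter xs)
  ... | false = length-filter xs

  count-none : (xs : List A) → (∀ x → ¬ P x) → count P? xs ≡ 0
  count-none xs ¬P = trans (∑-cong xs (λ x → cong ⟦_⟧ (dec-false (P? x) (¬P x))))
                           (trans (∑-const xs 0) (*-zeroʳ (length xs)))

  allᵛ?-cong : {Q : Pred A 0ℓ} (Q? : Decidable Q) (xs : Vec A k) →
               Allᵛ (λ x → does (P? x) ≡ does (Q? x)) xs → does (allᵛ? P? xs) ≡ does (allᵛ? Q? xs)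
  allᵛ?-cong Q? []       []          = refl
  allᵛ?-cong Q? (x ∷ xs) (eq ∷ eqs) = cong₂ _∧_ eq (allᵛ?-cong Q? xs eqs)

  allᵛ?-map : (f : B → A) (xs : Vec B k) → does (allᵛ? P? (map f xs)) ≡ does (allᵛ? (P? ∘ f) xs)
  allᵛ?-map f []       = refl
  allᵛ?-map f (x ∷ xs) = cong (does (P? (f x)) ∧_) (allᵛ?-map f xs)

  allᵛ?-insertAt : (xs : Vec A k) (i : Fin (suc k)) (x : A) →
                   does (allᵛ? P? (insertAt xs i x)) ≡ does (P? x) ∧ does (allᵛ? P? xs)
  allᵛ?-insertAt xs       zero    x = refl
  allᵛ?-insertAt (y ∷ xs) (suc i) x =
    trans (cong (does (P? y) ∧_) (allᵛ?-insertAt xs i x)) (∧-Props.x∙yz≈y∙xz (does (P? y)) (does (P? x)) _)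

  allᵛ?-∧ : {Q R : Pred A 0ℓ} (Q? : Decidable Q) (R? : Decidable R) →
            (∀ x → does (R? x) ≡ does (P? x) ∧ does (Q? x)) →
            (xs : Vec A k) → does (allᵛ? R? xs) ≡ does (allᵛ? P? xs) ∧ does (allᵛ? Q? xs)
  allᵛ?-∧ Q? R? R≡P∧Q []       = refl
  allᵛ?-∧ Q? R? R≡P∧Q (x ∷ xs) =
    trans (cong₂ _∧_ (R≡P∧Q x) (allᵛ?-∧ Q? R? R≡P∧Q xs)) (∧-Props.interchange (does (P? x)) (does (Q? x)) _ _)

unique-⊆⇒length≤ : {xs ys : List A} → Unique xs → All (_∈ ys) xs → length xs ≤ length ys
unique-⊆⇒length≤ {xs = []}     _             _               = z≤n
unique-⊆⇒length≤ {xs = x ∷ xs} (x∉xs ∷ !xs) (x∈ys ∷ xs⊆ys) with ∈-∃++ x∈ys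
... | pre , post , refl = begin
  suc (length xs)              ≤⟨ s≤s (unique-⊆⇒length≤ !xs (All.zipWith delete (x∉xs , xs⊆ys))) ⟩
  suc (length (pre ++ post))   ≡⟨ length-++-sucʳ pre x post ⟨
  length (pre ++ x ∷ post)     ∎
  where
  open ≤-Reasoning
  delete : ∀ {y} → ¬ x ≡ y × y ∈ pre ++ x ∷ post → y ∈ pre ++ post
  delete (x≢y , y∈) with ∈-++⁻ pre y∈
  ... | inj₁ y∈pre         = ∈-++⁺ˡ y∈pre
  ... | inj₂ (here y≡x)    = ⊥-elim (x≢y (sym y≡x))
  ... | inj₂ (there y∈post) = ∈-++⁺ʳ pre y∈post

count-<-length : {P : Pred A 0ℓ} (P? : Decidable P) {xs ys : List A} {z : A} →
                 Unique xs → (∀ {x} → P x → x ∈ ys) → z ∉ xs → z ∈ ys → suc (count P? xs) ≤ length ys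
count-<-length P? {xs} {ys} {z} !xs P⊆ys z∉xs z∈ys = begin
  suc (count P? xs)              ≡⟨ cong suc (length-filter P? xs) ⟨
  length (z ∷ filter P? xs)      ≤⟨ unique-⊆⇒length≤ unique (z∈ys ∷ All.map P⊆ys (all-filter P? xs)) ⟩
  length ys                      ∎
  where
  open ≤-Reasoning
  unique : Unique (z ∷ filter P? xs)
  unique = filter⁺ P? (¬Any⇒All¬ xs z∉xs) ∷ UniqueProperties.filter⁺ P? !xs

-- Enumerations

∑-allVecsOf-suc : (xs : List A) (k : ℕ) (f : Vec A (suc k) → ℕ) →
                  ∑ (allVecsOf xs (suc k)) f ≡ ∑ xs (λ x → ∑ (allVecsOf xs k) (λ v → f (x ∷ v)))
∑-allVecsOf-suc xs k f = trans (∑-concatMap _ xs f) (∑-cong xs (λ x → ∑-map (x ∷_) (allVecsOf xs k) f))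

length≡∑1 : (xs : List A) → length xs ≡ ∑ xs (λ _ → 1)
length≡∑1 xs = sym (trans (∑-const xs 1) (*-identityʳ (length xs)))

length-allVecsOf : (xs : List A) (k : ℕ) → length (allVecsOf xs k) ≡ length xs ^ k
length-allVecsOf xs zero    = refl
length-allVecsOf xs (suc k) = begin
  length (allVecsOf xs (suc k))                       ≡⟨ length≡∑1 (allVecsOf xs (suc k)) ⟩
  ∑ (allVecsOf xs (suc k)) (λ _ → 1)                  ≡⟨ ∑-allVecsOf-suc xs k _ ⟩
  ∑ xs (λ _ → ∑ (allVecsOf xs k) (λ _ → 1))           ≡⟨ ∑-cong xs (λ _ → sym (length≡∑1 (allVecsOf xs k))) ⟩
  ∑ xs (λ _ → length (allVecsOf xs k))                ≡⟨ ∑-const xs _ ⟩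
  length xs * length (allVecsOf xs k)                 ≡⟨ cong (length xs *_) (length-allVecsOf xs k) ⟩
  length xs ^ suc k                                   ∎
  where open ≡-Reasoning

allVecsOf-complete : {xs : List A} → (∀ x → x ∈ xs) → (v : Vec A k) → v ∈ allVecsOf xs k
allVecsOf-complete x∈xs []      = here refl
allVecsOf-complete x∈xs (x ∷ v) =
  ∈-concat⁺′ (∈-map⁺ (x ∷_) (allVecsOf-complete x∈xs v)) (∈-map⁺ _ (x∈xs x))

∈-allF2^ : (v : F2^ n) → v ∈ allF2^ n
∈-allF2^ = allVecsOf-complete λ { false → here refl ; true → there (here refl) }

∑-allF2^-suc : (f : F2^ (suc n) → ℕ) →
               ∑ (allF2^ (suc n)) f ≡ ∑ (allF2^ n) (λ b → f (false ∷ b)) + ∑ (allF2^ n) (λ b → f (true ∷ b))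
∑-allF2^-suc {n} f =
  trans (∑-allVecsOf-suc (false ∷ true ∷ []) n f) (cong (∑ (allF2^ n) (λ b → f (false ∷ b)) +_) (+-identityʳ _))

length-allLinMaps : length (allLinMaps n m) ≡ (2 ^ n) ^ m
length-allLinMaps {n} {m} = trans (length-allVecsOf (allF2^ n) m) (cong (_^ m) (length-allVecsOf _ n))

-- The group F₂ⁿ

infixl 6 _+V_
_+V_ : F2^ n → F2^ n → F2^ n
_+V_ = zipWith _xor_

+V-identityˡ : (v : F2^ n) → zeroV n +V v ≡ v
+V-identityˡ []      = refl
+V-identityˡ (x ∷ v) = cong (x ∷_) (+V-identityˡ v)

+V-self : (v : F2^ n) → v +V v ≡ zeroV n
+V-self []      = refl
+V-self (x ∷ v) = cong₂ _∷_ (xor-same x) (+V-self v)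

F2^-abelianGroup : ℕ → AbelianGroup 0ℓ 0ℓ
F2^-abelianGroup n = record
  { Carrier        = F2^ n
  ; _≈_            = _≡_
  ; _∙_            = _+V_
  ; ε              = zeroV n
  ; _⁻¹            = id
  ; isAbelianGroup = record
    { isGroup = record
      { isMonoid = record
        { isSemigroup = record { isMagma = isMagma _+V_ ; assoc = zipWith-assoc xor-assoc }
        ; identity    = +V-identityˡ , λ v → trans (zipWith-comm xor-comm v (zeroV n)) (+V-identityˡ v)
        }
      ; inverse = +V-self , +V-self
      ; ⁻¹-cong = cong id
      }
    ; comm = zipWith-comm xor-comm
    }
  }

module +V-Props {n : ℕ} where
  open AbelianGroup (F2^-abelianGroup n) public using (assoc; identityʳ)
  open AbelianGroupProperties (F2^-abelianGroup n) public using (inverseˡ-unique)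
  open CommutativeSemigroupProperties (AbelianGroup.commutativeSemigroup (F2^-abelianGroup n)) public
    using (interchange; x∙yz≈y∙xz; xy∙z≈xz∙y)

∑-translate : (c : F2^ n) (f : F2^ n → ℕ) → ∑ (allF2^ n) (λ b → f (b +V c)) ≡ ∑ (allF2^ n) f
∑-translate {zero}  []          f = refl
∑-translate {suc n} (false ∷ c) f = begin
  ∑ (allF2^ (suc n)) (λ b → f (b +V (false ∷ c)))
    ≡⟨ ∑-allF2^-suc (λ b → f (b +V (false ∷ c))) ⟩
  ∑ (allF2^ n) (λ b → f (false ∷ (b +V c))) + ∑ (allF2^ n) (λ b → f (true ∷ (b +V c)))
    ≡⟨ cong₂ _+_ (∑-translate c (f ∘ (false ∷_))) (∑-translate c (f ∘ (true ∷_))) ⟩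
  ∑ (allF2^ n) (λ b → f (false ∷ b)) + ∑ (allF2^ n) (λ b → f (true ∷ b))
    ≡⟨ ∑-allF2^-suc f ⟨
  ∑ (allF2^ (suc n)) f ∎
  where open ≡-Reasoning
∑-translate {suc n} (true ∷ c) f = begin
  ∑ (allF2^ (suc n)) (λ b → f (b +V (true ∷ c)))
    ≡⟨ ∑-allF2^-suc (λ b → f (b +V (true ∷ c))) ⟩
  ∑ (allF2^ n) (λ b → f (true ∷ (b +V c))) + ∑ (allF2^ n) (λ b → f (false ∷ (b +V c)))
    ≡⟨ +-comm (∑ (allF2^ n) (λ b → f (true ∷ (b +V c)))) _ ⟩
  ∑ (allF2^ n) (λ b → f (false ∷ (b +V c))) + ∑ (allF2^ n) (λ b → f (true ∷ (b +V c)))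
    ≡⟨ cong₂ _+_ (∑-translate c (f ∘ (false ∷_))) (∑-translate c (f ∘ (true ∷_))) ⟩
  ∑ (allF2^ n) (λ b → f (false ∷ b)) + ∑ (allF2^ n) (λ b → f (true ∷ b))
    ≡⟨ ∑-allF2^-suc f ⟨
  ∑ (allF2^ (suc n)) f ∎
  where open ≡-Reasoning

dot-distribˡ-+V : (b u w : F2^ n) → dot b (u +V w) ≡ dot b u xor dot b w
dot-distribˡ-+V []      []      []      = refl
dot-distribˡ-+V (β ∷ b) (x ∷ u) (y ∷ w) =
  trans (cong₂ _xor_ (∧-distribˡ-xor β x y) (dot-distribˡ-+V b u w))
        (xor-Props.interchange (β ∧ x) (β ∧ y) (dot b u) (dot b w))

dot-distribʳ-+V : (u w v : F2^ n) → dot (u +V w) v ≡ dot u v xor dot w v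
dot-distribʳ-+V []      []      []      = refl
dot-distribʳ-+V (β ∷ u) (γ ∷ w) (x ∷ v) =
  trans (cong₂ _xor_ (∧-distribʳ-xor x β γ) (dot-distribʳ-+V u w v))
        (xor-Props.interchange (β ∧ x) (γ ∧ x) (dot u v) (dot w v))

-- Linear combinations and independence

lincomb : F2^ k → Vec (F2^ n) k → F2^ n
lincomb {n = n} []   []      = zeroV n
lincomb (true  ∷ ss) (v ∷ T) = v +V lincomb ss T
lincomb (false ∷ ss) (v ∷ T) = lincomb ss T

lincomb-zeroV : (T : Vec (F2^ n) k) → lincomb (zeroV k) T ≡ zeroV n
lincomb-zeroV []      = refl
lincomb-zeroV (v ∷ T) = lincomb-zeroV T

lincomb-map : (f : F2^ n → F2^ m) → f (zeroV n) ≡ zeroV m → (∀ u w → f (u +V w) ≡ f u +V f w) →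
              (ss : F2^ k) (T : Vec (F2^ n) k) → lincomb ss (map f T) ≡ f (lincomb ss T)
lincomb-map f f0 f+ []           []      = sym f0
lincomb-map f f0 f+ (true  ∷ ss) (v ∷ T) = trans (cong (f v +V_) (lincomb-map f f0 f+ ss T)) (sym (f+ v _))
lincomb-map f f0 f+ (false ∷ ss) (v ∷ T) = lincomb-map f f0 f+ ss T

lincomb-insertAt : (ss : F2^ k) (T : Vec (F2^ n) k) (i : Fin (suc k)) (σ : Bool) (p : F2^ n) →
                   lincomb (insertAt ss i σ) (insertAt T i p) ≡ lincomb (σ ∷ ss) (p ∷ T)
lincomb-insertAt ss           T       zero    σ     p = refl
lincomb-insertAt (false ∷ ss) (v ∷ T) (suc i) false p = lincomb-insertAt ss T i false p
lincomb-insertAt (false ∷ ss) (v ∷ T) (suc i) true  p = lincomb-insertAt ss T i true p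
lincomb-insertAt (true  ∷ ss) (v ∷ T) (suc i) false p = cong (v +V_) (lincomb-insertAt ss T i false p)
lincomb-insertAt (true  ∷ ss) (v ∷ T) (suc i) true  p =
  trans (cong (v +V_) (lincomb-insertAt ss T i true p)) (+V-Props.x∙yz≈y∙xz v p (lincomb ss T))

insertAt-≡zeroV : (ss : F2^ k) (i : Fin (suc k)) (σ : Bool) → insertAt ss i σ ≡ zeroV (suc k) → ss ≡ zeroV k
insertAt-≡zeroV ss       zero    σ e = proj₂ (∷-injective e)
insertAt-≡zeroV (s ∷ ss) (suc i) σ e with ∷-injective e
... | s≡false , e′ = cong₂ _∷_ s≡false (insertAt-≡zeroV ss i σ e′)

Independent : Vec (F2^ n) k → Set
Independent {n} {k} T = ∀ ss → lincomb ss T ≡ zeroV n → ss ≡ zeroV k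

-- span t lists all 2^k combinations of t, with repetitions unless t is independent.
span : Vec (F2^ n) k → List (F2^ n)
span {k = k} t = List.map (λ ss → lincomb ss t) (allF2^ k)

_∈span?_ : (u : F2^ n) (t : Vec (F2^ n) k) → Dec (u ∈ span t)
u ∈span? t = any? (u ≟V_) (span t)

zeroV∈span : (t : Vec (F2^ n) k) → zeroV n ∈ span t
zeroV∈span {k = k} t = subst (_∈ span t) (lincomb-zeroV t) (∈-map⁺ (λ ss → lincomb ss t) (∈-allF2^ (zeroV k)))

length-span : (t : Vec (F2^ n) k) → length (span t) ≡ 2 ^ k
length-span {k = k} t = trans (length-map _ (allF2^ k)) (length-allVecsOf _ k)

-- Gaussian elimination

-- eliminate p v is the tail of v + (head v)·(true ∷ p): the first coordinate is cleared by the pivot true ∷ p.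
eliminate : F2^ n → F2^ (suc n) → F2^ n
eliminate p (false ∷ v) = v
eliminate p (true  ∷ v) = v +V p

eliminate-+V : (p : F2^ n) (u w : F2^ (suc n)) → eliminate p (u +V w) ≡ eliminate p u +V eliminate p w
eliminate-+V p (false ∷ u) (false ∷ w) = refl
eliminate-+V p (false ∷ u) (true  ∷ w) = +V-Props.assoc u w p
eliminate-+V p (true  ∷ u) (false ∷ w) = +V-Props.xy∙z≈xz∙y u w p
eliminate-+V p (true  ∷ u) (true  ∷ w) = begin
  u +V w                    ≡⟨ +V-Props.identityʳ (u +V w) ⟨
  u +V w +V zeroV _         ≡⟨ cong (u +V w +V_) (+V-self p) ⟨
  u +V w +V (p +V p)        ≡⟨ +V-Props.interchange u w p p ⟩
  u +V p +V (w +V p)        ∎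
  where open ≡-Reasoning

eliminate-kernel : (p : F2^ n) (w : F2^ (suc n)) → eliminate p w ≡ zeroV n → w ≡ zeroV (suc n) ⊎ w ≡ true ∷ p
eliminate-kernel p (false ∷ w) w≡0   = inj₁ (cong (false ∷_) w≡0)
eliminate-kernel p (true  ∷ w) w+p≡0 = inj₂ (cong (true ∷_) (+V-Props.inverseˡ-unique w p w+p≡0))

independent-eliminate : (R : Vec (F2^ (suc n)) k) (i : Fin (suc k)) (p : F2^ n) →
                        Independent (insertAt R i (true ∷ p)) → Independent (map (eliminate p) R)
independent-eliminate R i p indep ss e
  with eliminate-kernel p (lincomb ss R) (trans (sym (lincomb-map (eliminate p) refl (eliminate-+V p) ss R)) e)
... | inj₁ w≡0 = insertAt-≡zeroV ss i false (indep _ (trans (lincomb-insertAt ss R i false (true ∷ p)) w≡0))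
... | inj₂ w≡p = insertAt-≡zeroV ss i true (indep _ (begin
  lincomb (insertAt ss i true) (insertAt R i (true ∷ p))   ≡⟨ lincomb-insertAt ss R i true (true ∷ p) ⟩
  (true ∷ p) +V lincomb ss R                               ≡⟨ cong ((true ∷ p) +V_) w≡p ⟩
  (true ∷ p) +V (true ∷ p)                                 ≡⟨ +V-self (true ∷ p) ⟩
  zeroV _                                                  ∎))
  where open ≡-Reasoning

independent-map-false∷ : (T : Vec (F2^ n) k) → Independent (map (false ∷_) T) → Independent T
independent-map-false∷ T indep ss e =
  indep ss (trans (lincomb-map (false ∷_) refl (λ _ _ → refl) ss T) (cong (false ∷_) e))

data Pivot : Vec (F2^ (suc n)) k → Set where
  noPivot : (T : Vec (F2^ n) k) → Pivot (map (false ∷_) T)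
  pivotAt : (R : Vec (F2^ (suc n)) k) (i : Fin (suc k)) (p : F2^ n) → Pivot (insertAt R i (true ∷ p))

pivot : (T : Vec (F2^ (suc n)) k) → Pivot T
pivot []                = noPivot []
pivot ((true  ∷ p) ∷ T) = pivotAt T zero p
pivot ((false ∷ v) ∷ T) with pivot T
... | noPivot T′    = noPivot (v ∷ T′)
... | pivotAt R i p = pivotAt ((false ∷ v) ∷ R) (suc i) p

-- Level sets of families of linear functionals

OnLevel : Bool → Vec (F2^ n) k → F2^ n → Set
OnLevel c T b = Allᵛ (λ v → dot b v ≡ c) T

onLevel? : (c : Bool) (T : Vec (F2^ n) k) → Decidable (OnLevel c T)
onLevel? c T b = allᵛ? (λ v → dot b v ≟B c) T

levelSize : Bool → Vec (F2^ n) k → ℕ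
levelSize {n} c T = count (onLevel? c T) (allF2^ n)

levelSize-suc : (c : Bool) (T : Vec (F2^ (suc n)) k) →
                levelSize c T ≡
                ∑ (allF2^ n) (λ b → ⟦ does (onLevel? c T (false ∷ b)) ⟧ + ⟦ does (onLevel? c T (true ∷ b)) ⟧)
levelSize-suc {n} c T = trans (∑-allF2^-suc {n} (λ b → ⟦ does (onLevel? c T b) ⟧)) (sym (∑-+ (allF2^ n)))

levelSize-noPivot : (T : Vec (F2^ n) k) → levelSize false (map (false ∷_) T) ≡ 2 * levelSize false T
levelSize-noPivot {n} T = begin
  levelSize false T₀
    ≡⟨ levelSize-suc false T₀ ⟩
  ∑ (allF2^ n) (λ b → ⟦ does (onLevel? false T₀ (false ∷ b)) ⟧ + ⟦ does (onLevel? false T₀ (true ∷ b)) ⟧)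
    ≡⟨ ∑-cong (allF2^ n) (λ b → cong₂ _+_ (cong ⟦_⟧ (drop-head false b)) (cong ⟦_⟧ (drop-head true b))) ⟩
  ∑ (allF2^ n) (λ b → ⟦ does (onLevel? false T b) ⟧ + ⟦ does (onLevel? false T b) ⟧)
    ≡⟨ ∑-+ (allF2^ n) ⟩
  levelSize false T + levelSize false T
    ≡⟨ cong (levelSize false T +_) (+-identityʳ _) ⟨
  2 * levelSize false T ∎
  where
  open ≡-Reasoning
  T₀ = map (false ∷_) T
  drop-head : ∀ β b → does (onLevel? false T₀ (β ∷ b)) ≡ does (onLevel? false T b)
  drop-head β b = trans (allᵛ?-map _ (false ∷_) T)
                        (allᵛ?-cong _ _ T (universalᵛ (λ v → cong (λ d → does ((d xor dot b v) ≟B false)) (∧-zeroʳ β)) T))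

dot-eliminate : (b p : F2^ n) (v : F2^ (suc n)) → dot (dot b p ∷ b) v ≡ dot b (eliminate p v)
dot-eliminate b p (false ∷ v) = cong (_xor dot b v) (∧-zeroʳ (dot b p))
dot-eliminate b p (true  ∷ v) = begin
  (dot b p ∧ true) xor dot b v    ≡⟨ cong (_xor dot b v) (∧-identityʳ (dot b p)) ⟩
  dot b p xor dot b v             ≡⟨ xor-comm (dot b p) (dot b v) ⟩
  dot b v xor dot b p             ≡⟨ dot-distribˡ-+V b v p ⟨
  dot b (v +V p)                  ∎
  where open ≡-Reasoning

⟦⟧-one-solution : ∀ d (X : Bool → Bool) →
                  ⟦ does (d ≟B false) ∧ X false ⟧ + ⟦ does (not d ≟B false) ∧ X true ⟧ ≡ ⟦ X d ⟧
⟦⟧-one-solution false X = +-identityʳ _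
⟦⟧-one-solution true  X = refl

-- Exactly one head β, namely ⟨b, p⟩, gives ⟨β ∷ b, true ∷ p⟩ = 0, and for that β
-- ⟨β ∷ b, v⟩ = ⟨b, eliminate p v⟩.
levelSize-pivot : (R : Vec (F2^ (suc n)) k) (i : Fin (suc k)) (p : F2^ n) →
                  levelSize false (insertAt R i (true ∷ p)) ≡ levelSize false (map (eliminate p) R)
levelSize-pivot {n} R i p = trans (levelSize-suc false T) (∑-cong (allF2^ n) solve-head)
  where
  open ≡-Reasoning
  T = insertAt R i (true ∷ p)
  onR : F2^ (suc n) → Bool
  onR b = does (onLevel? false R b)
  solve-head : ∀ b → ⟦ does (onLevel? false T (false ∷ b)) ⟧ + ⟦ does (onLevel? false T (true ∷ b)) ⟧
                     ≡ ⟦ does (onLevel? false (map (eliminate p) R) b) ⟧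
  solve-head b = begin
    ⟦ does (onLevel? false T (false ∷ b)) ⟧ + ⟦ does (onLevel? false T (true ∷ b)) ⟧
      ≡⟨ cong₂ _+_ (cong ⟦_⟧ (allᵛ?-insertAt _ R i (true ∷ p))) (cong ⟦_⟧ (allᵛ?-insertAt _ R i (true ∷ p))) ⟩
    ⟦ does (dot b p ≟B false) ∧ onR (false ∷ b) ⟧ + ⟦ does (not (dot b p) ≟B false) ∧ onR (true ∷ b) ⟧
      ≡⟨ ⟦⟧-one-solution (dot b p) (λ β → onR (β ∷ b)) ⟩
    ⟦ onR (dot b p ∷ b) ⟧
      ≡⟨ cong ⟦_⟧ (allᵛ?-cong _ _ R (universalᵛ (λ v → cong (λ d → does (d ≟B false)) (dot-eliminate b p v)) R)) ⟩
    ⟦ does (allᵛ? (λ v → dot b (eliminate p v) ≟B false) R) ⟧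
      ≡⟨ cong ⟦_⟧ (allᵛ?-map _ (eliminate p) R) ⟨
    ⟦ does (onLevel? false (map (eliminate p) R) b) ⟧ ∎

xor-≟-cancel : ∀ x c → does ((x xor c) ≟B c) ≡ does (x ≟B false)
xor-≟-cancel false false = refl
xor-≟-cancel false true  = refl
xor-≟-cancel true  false = refl
xor-≟-cancel true  true  = refl

levelSize-translate : (c : Bool) (T : Vec (F2^ n) k) (b₀ : F2^ n) → OnLevel c T b₀ → levelSize c T ≡ levelSize false T
levelSize-translate {n} c T b₀ b₀∈ = begin
  levelSize c T                                                ≡⟨ ∑-translate b₀ _ ⟨
  ∑ (allF2^ n) (λ b → ⟦ does (onLevel? c T (b +V b₀)) ⟧)       ≡⟨ ∑-cong (allF2^ n) (λ b → cong ⟦_⟧ (shift b)) ⟩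
  levelSize false T                                            ∎
  where
  open ≡-Reasoning
  shift : ∀ b → does (onLevel? c T (b +V b₀)) ≡ does (onLevel? false T b)
  shift b = allᵛ?-cong _ _ T (Allᵛ.map (λ {v} b₀v≡c → begin
    does (dot (b +V b₀) v ≟B c)          ≡⟨ cong (λ d → does (d ≟B c)) (dot-distribʳ-+V b b₀ v) ⟩
    does ((dot b v xor dot b₀ v) ≟B c)   ≡⟨ cong (λ d → does ((dot b v xor d) ≟B c)) b₀v≡c ⟩
    does ((dot b v xor c) ≟B c)          ≡⟨ xor-≟-cancel (dot b v) c ⟩
    does (dot b v ≟B false)              ∎) b₀∈)

-- A nonempty level set is a translate of the annihilator.
levelSize≤annihilator : (c : Bool) (T : Vec (F2^ n) k) → levelSize c T ≤ levelSize false T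
levelSize≤annihilator {n} c T with any? (onLevel? c T) (allF2^ n)
... | yes some = let b₀ , b₀∈ = satisfied some in ≤-reflexive (levelSize-translate c T b₀ b₀∈)
... | no none  = ≤-trans (≤-reflexive empty) z≤n
  where
  empty : levelSize c T ≡ 0
  empty = count-none (onLevel? c T) (allF2^ n) (λ b b∈ → none (lose (∈-allF2^ b) b∈))

annihilator-bound : (T : Vec (F2^ n) k) → Independent T → levelSize false T * 2 ^ k ≤ 2 ^ n
annihilator-bound {zero}  {zero}  []      _     = ≤-refl
annihilator-bound {zero}  {suc k} ([] ∷ T) indep with indep (true ∷ zeroV k) (cong ([] +V_) (lincomb-zeroV T))
... | ()
annihilator-bound {suc n} T indep with pivot T
annihilator-bound {suc n} {k} _ indep | noPivot T′ = begin
  levelSize false (map (false ∷_) T′) * 2 ^ k   ≡⟨ cong (_* 2 ^ k) (levelSize-noPivot T′) ⟩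
  2 * levelSize false T′ * 2 ^ k                ≡⟨ *-assoc 2 (levelSize false T′) (2 ^ k) ⟩
  2 * (levelSize false T′ * 2 ^ k)
    ≤⟨ *-monoʳ-≤ 2 (annihilator-bound T′ (independent-map-false∷ T′ indep)) ⟩
  2 * 2 ^ n                                     ∎
  where open ≤-Reasoning
annihilator-bound {suc n} {suc k} _ indep | pivotAt R i p = begin
  levelSize false (insertAt R i (true ∷ p)) * (2 * 2 ^ k)   ≡⟨ cong (_* (2 * 2 ^ k)) (levelSize-pivot R i p) ⟩
  levelSize false R′ * (2 * 2 ^ k)                          ≡⟨ *-Props.x∙yz≈y∙xz (levelSize false R′) 2 (2 ^ k) ⟩
  2 * (levelSize false R′ * 2 ^ k)
    ≤⟨ *-monoʳ-≤ 2 (annihilator-bound R′ (independent-eliminate R i p indep)) ⟩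
  2 * 2 ^ n                                                 ∎
  where
  open ≤-Reasoning
  R′ = map (eliminate p) R

-- Maps sending every vector of a tuple to y

fiberSize : Vec (F2^ n) k → F2^ m → ℕ
fiberSize {n} {m = m} t y = count (λ B → allᵛ? (λ u → apply B u ≟V y) t) (allLinMaps n m)

fiberSize-∷ : (t : Vec (F2^ n) k) (c : Bool) (y : F2^ m) → fiberSize t (c ∷ y) ≡ levelSize c t * fiberSize t y
fiberSize-∷ {n} {m = m} t c y = begin
  fiberSize t (c ∷ y)
    ≡⟨ ∑-allVecsOf-suc (allF2^ n) m _ ⟩
  ∑ (allF2^ n) (λ b → ∑ (allLinMaps n m) (λ B → ⟦ does (allᵛ? (λ u → apply (b ∷ B) u ≟V (c ∷ y)) t) ⟧))
    ≡⟨ ∑-cong (allF2^ n) (λ b → ∑-cong (allLinMaps n m) (λ B → split-row b B)) ⟩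
  ∑ (allF2^ n) (λ b → ∑ (allLinMaps n m) (λ B → ⟦ does (onLevel? c t b) ⟧ * ⟦ does (mapsTo? B) ⟧))
    ≡⟨ ∑-product (allF2^ n) (allLinMaps n m) _ _ ⟩
  levelSize c t * fiberSize t y ∎
  where
  open ≡-Reasoning
  mapsTo? : (B : LinMap n m) → Dec (Allᵛ (λ u → apply B u ≡ y) t)
  mapsTo? B = allᵛ? (λ u → apply B u ≟V y) t
  split-row : ∀ b B → ⟦ does (allᵛ? (λ u → apply (b ∷ B) u ≟V (c ∷ y)) t) ⟧
                      ≡ ⟦ does (onLevel? c t b) ⟧ * ⟦ does (mapsTo? B) ⟧
  split-row b B = trans
    (cong ⟦_⟧ (allᵛ?-∧ (λ u → dot b u ≟B c) (λ u → apply B u ≟V y) (λ u → apply (b ∷ B) u ≟V (c ∷ y)) (λ _ → refl) t))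
    (⟦⟧-∧ (does (onLevel? c t b)) (does (mapsTo? B)))

fiber-bound : (t : Vec (F2^ n) k) → Independent t → (y : F2^ m) → fiberSize t y * (2 ^ k) ^ m ≤ (2 ^ n) ^ m
fiber-bound t indep []      =
  ≤-trans (≤-reflexive (trans (*-identityʳ _) (+-identityʳ _))) (⟦⟧≤1 (does (allᵛ? (λ u → [] ≟V []) t)))
fiber-bound {n} {k} {suc m} t indep (c ∷ y) = begin
  fiberSize t (c ∷ y) * (2 ^ k * (2 ^ k) ^ m)              ≡⟨ cong (_* (2 ^ k * (2 ^ k) ^ m)) (fiberSize-∷ t c y) ⟩
  levelSize c t * fiberSize t y * (2 ^ k * (2 ^ k) ^ m)    ≡⟨ *-Props.interchange (levelSize c t) (fiberSize t y) (2 ^ k) _ ⟩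
  levelSize c t * 2 ^ k * (fiberSize t y * (2 ^ k) ^ m)    ≤⟨ *-mono-≤ level-bound (fiber-bound t indep y) ⟩
  2 ^ n * (2 ^ n) ^ m                                      ∎
  where
  open ≤-Reasoning
  level-bound : levelSize c t * 2 ^ k ≤ 2 ^ n
  level-bound = ≤-trans (*-monoˡ-≤ (2 ^ k) (levelSize≤annihilator c t)) (annihilator-bound t indep)

-- Greedy tuples

Greedy : Vec (F2^ n) k → Set
Greedy []      = ⊤
Greedy (u ∷ t) = u ∉ span t × Greedy t

greedy? : (t : Vec (F2^ n) k) → Dec (Greedy t)
greedy? []      = yes tt
greedy? (u ∷ t) = ¬? (u ∈span? t) ×-dec greedy? t

greedy⇒independent : (t : Vec (F2^ n) k) → Greedy t → Independent t
greedy⇒independent []      _         []           _ = refl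
greedy⇒independent (u ∷ t) (_ , g)   (false ∷ ss) e = cong (false ∷_) (greedy⇒independent t g ss e)
greedy⇒independent (u ∷ t) (u∉ , _)  (true  ∷ ss) e =
  ⊥-elim (u∉ (subst (_∈ span t) (sym (+V-Props.inverseˡ-unique u (lincomb ss t) e)) (∈-map⁺ _ (∈-allF2^ ss))))

⟦⟧-split : ∀ a b → ⟦ a ⟧ ≤ ⟦ not b ∧ a ⟧ + ⟦ b ⟧
⟦⟧-split false b     = z≤n
⟦⟧-split true  false = ≤-refl
⟦⟧-split true  true  = ≤-refl

greedyWeight : {good : Pred (F2^ n) 0ℓ} → Decidable good → Vec (F2^ n) k → ℕ
greedyWeight good? t = ⟦ does (greedy? t) ⟧ * ⟦ does (allᵛ? good? t) ⟧

greedyWeight-∷ : {good : Pred (F2^ n) 0ℓ} (good? : Decidable good) (u : F2^ n) (t : Vec (F2^ n) k) →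
                 greedyWeight good? (u ∷ t) ≡ greedyWeight good? t * ⟦ not (does (u ∈span? t)) ∧ does (good? u) ⟧
greedyWeight-∷ good? u t = begin
  ⟦ fresh ∧ g ⟧ * ⟦ gu ∧ a ⟧            ≡⟨ ⟦⟧-∧ (fresh ∧ g) (gu ∧ a) ⟨
  ⟦ (fresh ∧ g) ∧ (gu ∧ a) ⟧            ≡⟨ cong ⟦_⟧ (∧-Props.interchange fresh g gu a) ⟩
  ⟦ (fresh ∧ gu) ∧ (g ∧ a) ⟧            ≡⟨ cong ⟦_⟧ (∧-comm (fresh ∧ gu) (g ∧ a)) ⟩
  ⟦ (g ∧ a) ∧ (fresh ∧ gu) ⟧            ≡⟨ ⟦⟧-∧ (g ∧ a) (fresh ∧ gu) ⟩
  ⟦ g ∧ a ⟧ * ⟦ fresh ∧ gu ⟧            ≡⟨ cong (_* ⟦ fresh ∧ gu ⟧) (⟦⟧-∧ g a) ⟩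
  ⟦ g ⟧ * ⟦ a ⟧ * ⟦ fresh ∧ gu ⟧        ∎
  where
  open ≡-Reasoning
  fresh = not (does (u ∈span? t))
  g     = does (greedy? t)
  gu    = does (good? u)
  a     = does (allᵛ? good? t)

module _ {good : Pred (F2^ n) 0ℓ} (good? : Decidable good) {U : List (F2^ n)} (r : ℕ)
         (!U : Unique U) (0∉U : zeroV n ∉ U) (r<good : suc r ≤ count good? U) where

  -- span t has at most 2^k elements, one of which is 0 ∉ U.
  good-outside-span : (t : Vec (F2^ n) k) →
                      r + 2 ∸ 2 ^ k ≤ ∑ U (λ u → ⟦ not (does (u ∈span? t)) ∧ does (good? u) ⟧)
  good-outside-span {k} t = begin
    r + 2 ∸ 2 ^ k                   ≤⟨ ∸-monoʳ-≤ (r + 2) inSpan<2^k ⟩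
    r + 2 ∸ suc inSpan              ≡⟨ cong (_∸ suc inSpan) (+-comm r 2) ⟩
    suc r ∸ inSpan                  ≤⟨ m≤n+o⇒m∸n≤o (suc r) inSpan r<inSpan+outside ⟩
    outside                         ∎
    where
    open ≤-Reasoning
    inSpan  = count (_∈span? t) U
    outside = ∑ U (λ u → ⟦ not (does (u ∈span? t)) ∧ does (good? u) ⟧)
    inSpan<2^k : suc inSpan ≤ 2 ^ k
    inSpan<2^k = subst (suc inSpan ≤_) (length-span t) (count-<-length (_∈span? t) !U id 0∉U (zeroV∈span t))
    good≤ : count good? U ≤ outside + inSpan
    good≤ = ≤-trans (∑-mono U (λ u → ⟦⟧-split (does (good? u)) (does (u ∈span? t)))) (≤-reflexive (∑-+ U))
    r<inSpan+outside : suc r ≤ inSpan + outside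
    r<inSpan+outside = ≤-trans r<good (≤-trans good≤ (≤-reflexive (+-comm outside inSpan)))

  greedy-bound : (k : ℕ) → prodTerm r k ≤ ∑ (allVecsOf U k) (greedyWeight good?)
  greedy-bound zero    = ≤-refl
  greedy-bound (suc k) = begin
    prodTerm r k * (r + 2 ∸ 2 ^ k)
      ≤⟨ *-monoˡ-≤ (r + 2 ∸ 2 ^ k) (greedy-bound k) ⟩
    ∑ (allVecsOf U k) (greedyWeight good?) * (r + 2 ∸ 2 ^ k)
      ≡⟨ ∑-*ʳ (r + 2 ∸ 2 ^ k) (allVecsOf U k) _ ⟨
    ∑ (allVecsOf U k) (λ t → greedyWeight good? t * (r + 2 ∸ 2 ^ k))
      ≤⟨ ∑-mono (allVecsOf U k) (λ t → *-monoʳ-≤ (greedyWeight good? t) (good-outside-span t)) ⟩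
    ∑ (allVecsOf U k) (λ t → greedyWeight good? t * ∑ U (λ u → ⟦ not (does (u ∈span? t)) ∧ does (good? u) ⟧))
      ≡⟨ ∑-cong (allVecsOf U k) (λ t → trans (∑-cong U (λ u → greedyWeight-∷ good? u t))
                                               (∑-*ˡ (greedyWeight good? t) U _)) ⟨
    ∑ (allVecsOf U k) (λ t → ∑ U (λ u → greedyWeight good? (u ∷ t)))
      ≡⟨ ∑-swap (allVecsOf U k) U _ ⟩
    ∑ U (λ u → ∑ (allVecsOf U k) (λ t → greedyWeight good? (u ∷ t)))
      ≡⟨ ∑-allVecsOf-suc U k _ ⟨
    ∑ (allVecsOf U (suc k)) (greedyWeight good?) ∎
    where open ≤-Reasoning

bad-maps-bound : (U : List (F2^ n)) → Unique U → length U ≡ 2 ^ m → zeroV n ∉ U → (y : F2^ m) (r a : ℕ) →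
                 countBad U y r * prodTerm r a ≤ length (allLinMaps n m)
bad-maps-bound {n} {m} U !U ∣U∣≡2^m 0∉U y r a = begin
  countBad U y r * prodTerm r a
    ≡⟨ cong (_* prodTerm r a) (length-filter (λ B → r <? Z U y B) Maps) ⟩
  count (λ B → r <? Z U y B) Maps * prodTerm r a
    ≡⟨ ∑-*ʳ (prodTerm r a) Maps _ ⟨
  ∑ Maps (λ B → ⟦ does (r <? Z U y B) ⟧ * prodTerm r a)
    ≤⟨ ∑-mono Maps (λ B → ⟦does⟧*-≤ (r <? Z U y B) (λ r<Z →
         greedy-bound (maps-to? B) r !U 0∉U (subst (suc r ≤_) (length-filter (maps-to? B) U) r<Z) a)) ⟩
  ∑ Maps (λ B → ∑ Tuples (greedyWeight (maps-to? B)))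
    ≡⟨ ∑-swap Maps Tuples _ ⟩
  ∑ Tuples (λ t → ∑ Maps (λ B → greedyWeight (maps-to? B) t))
    ≡⟨ ∑-cong Tuples (λ t → ∑-*ˡ ⟦ does (greedy? t) ⟧ Maps _) ⟩
  ∑ Tuples (λ t → ⟦ does (greedy? t) ⟧ * fiberSize t y)
    ≤⟨ ∑≤-by-shares Tuples share-bound ⟩
  (2 ^ n) ^ m
    ≡⟨ length-allLinMaps {n} {m} ⟨
  length Maps ∎
  where
  open ≤-Reasoning
  Maps   = allLinMaps n m
  Tuples = allVecsOf U a
  maps-to? : (B : LinMap n m) (u : F2^ n) → Dec (apply B u ≡ y)
  maps-to? B u = apply B u ≟V y
  ∣Tuples∣ : length Tuples ≡ (2 ^ a) ^ m
  ∣Tuples∣ = begin-equality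
    length Tuples    ≡⟨ length-allVecsOf U a ⟩
    length U ^ a     ≡⟨ cong (_^ a) ∣U∣≡2^m ⟩
    (2 ^ m) ^ a      ≡⟨ ^-*-assoc 2 m a ⟩
    2 ^ (m * a)      ≡⟨ cong (2 ^_) (*-comm m a) ⟩
    2 ^ (a * m)      ≡⟨ ^-*-assoc 2 a m ⟨
    (2 ^ a) ^ m      ∎
  share-bound : ∀ t → ⟦ does (greedy? t) ⟧ * fiberSize t y * length Tuples ≤ (2 ^ n) ^ m
  share-bound t = begin
    ⟦ does (greedy? t) ⟧ * fiberSize t y * length Tuples
      ≡⟨ *-assoc ⟦ does (greedy? t) ⟧ (fiberSize t y) _ ⟩
    ⟦ does (greedy? t) ⟧ * (fiberSize t y * length Tuples)
      ≡⟨ cong (λ N → ⟦ does (greedy? t) ⟧ * (fiberSize t y * N)) ∣Tuples∣ ⟩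
    ⟦ does (greedy? t) ⟧ * (fiberSize t y * (2 ^ a) ^ m)
      ≤⟨ ⟦does⟧*-≤ (greedy? t) (λ g → fiber-bound t (greedy⇒independent t g) y) ⟩
    (2 ^ n) ^ m ∎

-- bad-maps-bound holds for every a, but for a > aOf r the factor r + 2 ∸ 2 ^ aOf r of prodTerm r a is 0.
theorem2p2 : (n m : ℕ) (U : List (F2^ n)) → Unique U → length U ≡ 2 ^ m → All (λ u → ¬ (u ≡ zeroV n)) U → (y : F2^ m) (r : ℕ) → countBad U y r * prodTerm r (aOf r) ≤ length (allLinMaps n m)
theorem2p2 n m U !U ∣U∣≡2^m nonzero y r =
  bad-maps-bound U !U ∣U∣≡2^m (All¬⇒¬Any (All.map (_∘ sym) nonzero)) y r (aOf r)
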